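{- Let $\mathcal{A}_n$ denote the set of CNATs of size $n$ all of whose leaves are short, and $\mathcal{T}_n$ the set of CNATs of size $n$. For every $p\ge 0$ the set $\mathcal{A}_{2p+1}$ is empty, and for every $p\ge 1$ the set $\mathcal{A}_{2p}$ is in bijection with $\mathcal{T}_p$.
   Context: A non-ambiguous tree (NAT) is a filling of a rectangular grid in which each cell is dotted or not, such that: the top-left cell is dotted (the root); every dotted cell other than the root has either a dotted cell above it in the same column or a dotted cell to its left in the same row, but not both; and every row and every column contains at least one dotted cell. Each non-root dot has a parent: the nearest dot above it in its column, or the nearest dot to its left in its row. A complete non-ambiguous tree (CNAT) is a NAT in which every dot either has both a dot below it in its column and a dot to its right in its row (an internal dot), or neither (a leaf). The size of a CNAT is its number of leaves. A leaf is short if its parent lies in a cell adjacent to it, and long otherwise. -}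

module Defs where

open import Data.Nat using (ℕ; zero; suc; _+_)
open import Data.Fin using (Fin; toℕ) renaming (zero to fzero; _<_ to _<ꟳ_)
open import Data.Fin.Properties using (any?) renaming (_<?_ to _<ꟳ?_)
open import Data.Bool using (Bool; true; false; if_then_else_)
open import Data.Bool.Properties using () renaming (_≟_ to _≟ᵇ_)
open import Data.Vec using (Vec; lookup; tabulate; toList)
import Data.Vec as Vec
open import Data.List using (List)
open import Data.Product using (Σ; ∃; _×_; _,_; proj₁)
open import Data.Product.Properties using ()
open import Relation.Nullary.Decidable using (Dec; does; _×-dec_; ¬?)
open import Data.Sum using (_⊎_)
open import Relation.Nullary using (¬_)
open import Relation.Binary.PropositionalEquality using (_≡_; setoid)
open import Relation.Binary.Bundles using (Setoid)
import Relation.Binary.Construct.On as On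
open import Level using (0ℓ)

-- A filling with (suc h) rows and (suc w) columns; rows are indexed
-- top to bottom, columns left to right; a cell is dotted iff its entry
-- is true.  (A NAT needs a top-left cell, so the grid is non-empty.)

Grid : ℕ → ℕ → Set
Grid h w = Vec (Vec Bool (suc w)) (suc h)

module _ {h w : ℕ} (g : Grid h w) where

  Dot : Fin (suc h) → Fin (suc w) → Set
  Dot i j = lookup (lookup g i) j ≡ true

  dot? : ∀ i j → Dec (Dot i j)
  dot? i j = lookup (lookup g i) j ≟ᵇ true

  Above Below : Fin (suc h) → Fin (suc w) → Set
  Above i j = ∃ λ i' → i' <ꟳ i × Dot i' j
  Below i j = ∃ λ i' → i <ꟳ i' × Dot i' j

  Left Right : Fin (suc h) → Fin (suc w) → Set
  Left  i j = ∃ λ j' → j' <ꟳ j × Dot i j'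
  Right i j = ∃ λ j' → j <ꟳ j' × Dot i j'

  IsRoot : Fin (suc h) → Fin (suc w) → Set
  IsRoot i j = i ≡ fzero × j ≡ fzero

  record IsNAT : Set where
    field
      root-dotted : Dot fzero fzero
      non-root    : ∀ i j → Dot i j → ¬ IsRoot i j →
                    (Above i j × ¬ Left i j) ⊎ (¬ Above i j × Left i j)
      rows-nonempty : ∀ i → ∃ λ j → Dot i j
      cols-nonempty : ∀ j → ∃ λ i → Dot i j

  Internal Leaf : Fin (suc h) → Fin (suc w) → Set
  Internal i j = Dot i j × Below i j × Right i j
  Leaf     i j = Dot i j × ¬ Below i j × ¬ Right i j

  record IsCNAT : Set where
    field
      isNAT    : IsNAT
      complete : ∀ i j → Dot i j → Internal i j ⊎ Leaf i j

  leaf? : ∀ i j → Dec (Leaf i j)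
  leaf? i j = dot? i j ×-dec (¬? (any? λ i' → (i <ꟳ? i') ×-dec dot? i' j))
                       ×-dec (¬? (any? λ j' → (j <ꟳ? j') ×-dec dot? i j'))

  numLeaves : ℕ
  numLeaves = Vec.sum (tabulate λ i → Vec.sum (tabulate λ j →
                if does (leaf? i j) then 1 else 0))

  ParentAbove : Fin (suc h) → Fin (suc h) → Fin (suc w) → Set
  ParentAbove i' i j = i' <ꟳ i × Dot i' j ×
                       (∀ k → i' <ꟳ k → k <ꟳ i → ¬ Dot k j)
  ParentLeft : Fin (suc w) → Fin (suc h) → Fin (suc w) → Set
  ParentLeft j' i j = j' <ꟳ j × Dot i j' ×
                      (∀ k → j' <ꟳ k → k <ꟳ j → ¬ Dot i k)

  -- a leaf is short if its parent lies in a cell adjacent to it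
  -- (a parent lies above or to the left, so adjacency means the cell
  -- immediately above resp. immediately to the left)
  ShortLeaf : Fin (suc h) → Fin (suc w) → Set
  ShortLeaf i j = Leaf i j ×
    ((∃ λ i' → ParentAbove i' i j × toℕ i ≡ suc (toℕ i')) ⊎
     (∃ λ j' → ParentLeft j' i j × toℕ j ≡ suc (toℕ j')))

  AllLeavesShort : Set
  AllLeavesShort = ∀ i j → Leaf i j → ShortLeaf i j

record CNAT : Set where
  constructor cnat
  field
    h w    : ℕ
    grid   : Grid h w
    isCNAT : IsCNAT grid

open CNAT public

size : CNAT → ℕ
size t = numLeaves (grid t)

-- the filling, as a list of rows; it determines the dimensions
filling : CNAT → List (List Bool)
filling t = toList (Vec.map toList (grid t))

𝒯 : ℕ → Set
𝒯 n = Σ CNAT λ t → size t ≡ n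

𝒜 : ℕ → Set
𝒜 n = Σ CNAT λ t → size t ≡ n × AllLeavesShort (grid t)

-- As sets, two CNATs are the same iff they have the same filling
-- (proof components are irrelevant).
𝒯-setoid : ℕ → Setoid 0ℓ 0ℓ
𝒯-setoid n = On.setoid (setoid (List (List Bool))) (λ (x : 𝒯 n) → filling (proj₁ x))

𝒜-setoid : ℕ → Setoid 0ℓ 0ℓ
𝒜-setoid n = On.setoid (setoid (List (List Bool))) (λ (x : 𝒜 n) → filling (proj₁ x))

-- Expanding a CNAT T turns each leaf into an internal dot with two short leaves: row a and column b
-- of T become row 2a and column 2b, and a leaf at (a, b) gains children at (2a + 1, 2b) and
-- (2a, 2b + 1).  This gives a CNAT with only short leaves and twice as many leaves as T.
-- Conversely, let all leaves of a CNAT be short.  A leaf to the right of its parent (a, b) always has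
-- a sibling leaf at (a + 1, b): an unpaired one would produce another unpaired one in a lower row,
-- and so on forever.  Consequently the rows containing a leaf below its parent are exactly the odd
-- ones, likewise for columns, the odd rows and columns consist of the sibling pairs, and the grid is
-- the expansion of its even rows and columns.  So the size is even, and contracting to the even rows
-- and columns inverts the expansion.

module Submission where

open import Defs
open import Data.Nat using (ℕ; zero; suc; _+_; _*_; _≤_; _<_; z≤n; s≤s; s≤s⁻¹; _≤?_; _<?_; ⌊_/2⌋)
open import Data.Nat.Properties
open import Data.Fin using (Fin; toℕ; fromℕ<) renaming (zero to fzero; suc to fsuc)
open import Data.Fin.Properties using (toℕ<n; toℕ-injective; fromℕ<-toℕ; toℕ-fromℕ<)
open import Data.Bool using (Bool; true; false; if_then_else_)
import Data.Bool.Properties as Bool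
open import Data.Vec using (Vec; []; _∷_; lookup; tabulate; toList)
import Data.Vec as Vec
open import Data.List using (List)
import Data.List as List
open import Data.List.Properties using (∷-injectiveˡ; ∷-injectiveʳ)
import Data.Vec.Properties as Vecₚ
open import Data.Vec.Relation.Binary.Equality.Cast using (cast-is-id)
open import Data.Product
open import Data.Sum using (_⊎_; inj₁; inj₂)
import Data.Sum
open import Data.Empty using (⊥; ⊥-elim)
open import Function using (_∘_; flip)
open import Relation.Nullary using (¬_; Dec; yes; no; does)
open import Relation.Nullary.Decidable using (dec-true; _×-dec_)
open import Relation.Binary.Definitions using (tri<; tri≈; tri>)
open import Relation.Binary.PropositionalEquality
open import Algebra.Properties.CommutativeSemigroup +-commutativeSemigroup using (interchange)
open import Function.Bundles using (Bijection)
open import Function.Definitions using (Congruent; Injective; Surjective)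
open import Relation.Binary.Bundles using (Setoid)

double : ℕ → ℕ
double zero    = zero
double (suc n) = suc (suc (double n))

isOdd : ℕ → Bool
isOdd zero          = false
isOdd (suc zero)    = true
isOdd (suc (suc n)) = isOdd n

Odd : ℕ → Set
Odd n = ∃ λ n₀ → n ≡ suc (double n₀)

data Parity : ℕ → Set where
  even : ∀ a → Parity (double a)
  odd  : ∀ a → Parity (suc (double a))

parity : ∀ n → Parity n
parity zero = even zero
parity (suc n) with parity n
... | even a = odd a
... | odd a  = even (suc a)

⌊double/2⌋ : ∀ a → ⌊ double a /2⌋ ≡ a
⌊double/2⌋ zero    = refl
⌊double/2⌋ (suc a) = cong suc (⌊double/2⌋ a)

⌊suc-double/2⌋ : ∀ a → ⌊ suc (double a) /2⌋ ≡ a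
⌊suc-double/2⌋ zero    = refl
⌊suc-double/2⌋ (suc a) = cong suc (⌊suc-double/2⌋ a)

isOdd-double : ∀ a → isOdd (double a) ≡ false
isOdd-double zero    = refl
isOdd-double (suc a) = isOdd-double a

isOdd-suc-double : ∀ a → isOdd (suc (double a)) ≡ true
isOdd-suc-double zero    = refl
isOdd-suc-double (suc a) = isOdd-suc-double a

2*n≡double : ∀ n → 2 * n ≡ double n
2*n≡double zero    = refl
2*n≡double (suc n) = begin
  suc (n + suc (n + 0))  ≡⟨ cong suc (+-suc n (n + 0)) ⟩
  suc (suc (2 * n))      ≡⟨ cong (λ m → suc (suc m)) (2*n≡double n) ⟩
  suc (suc (double n))   ∎
  where open ≡-Reasoning

double≢suc-double : ∀ a b → double a ≢ suc (double b)
double≢suc-double zero    b       ()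
double≢suc-double (suc a) zero    ()
double≢suc-double (suc a) (suc b) eq =
  double≢suc-double a b (suc-injective (suc-injective eq))

double≡0⇒≡0 : ∀ a → double a ≡ 0 → a ≡ 0
double≡0⇒≡0 zero _ = refl

double-mono-≤ : ∀ {a b} → a ≤ b → double a ≤ double b
double-mono-≤ {zero}          _       = z≤n
double-mono-≤ {suc a} {suc b} (s≤s p) = s≤s (s≤s (double-mono-≤ p))

double-mono-< : ∀ {a b} → a < b → double a < double b
double-mono-< p = ≤-trans (n≤1+n _) (double-mono-≤ p)

double-cancel-≤ : ∀ {a b} → double a ≤ suc (double b) → a ≤ b
double-cancel-≤ {zero}          _             = z≤n
double-cancel-≤ {suc a} {suc b} (s≤s (s≤s p)) = s≤s (double-cancel-≤ p)

double-cancel-< : ∀ {a b} → double a < double b → a < b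
double-cancel-< {zero}  {suc b} _             = s≤s z≤n
double-cancel-< {suc a} {suc b} (s≤s (s≤s p)) = s≤s (double-cancel-< p)

suc-double<double⇒< : ∀ {a b} → suc (double a) < double b → a < b
suc-double<double⇒< p = double-cancel-< (≤-trans (n≤1+n _) p)

double<suc-double⇒≤ : ∀ {a b} → double a < suc (double b) → a ≤ b
double<suc-double⇒≤ p = double-cancel-≤ (m≤n⇒m≤1+n (s≤s⁻¹ p))

suc-double<suc-double⇒< : ∀ {a b} → suc (double a) < suc (double b) → a < b
suc-double<suc-double⇒< p = double-cancel-< (s≤s⁻¹ p)

count : Bool → ℕ
count b = if b then 1 else 0

does≡true⇒ : ∀ {A : Set} (a? : Dec A) → does a? ≡ true → A
does≡true⇒ (yes a) _ = a

true⇔true⇒≡ : ∀ {b b′} → (b ≡ true → b′ ≡ true) → (b′ ≡ true → b ≡ true) → b ≡ b′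
true⇔true⇒≡ {true}  {true}  _ _ = refl
true⇔true⇒≡ {true}  {false} f _ = sym (f refl)
true⇔true⇒≡ {false} {true}  _ g = g refl
true⇔true⇒≡ {false} {false} _ _ = refl

-- Grids indexed by natural numbers, empty outside their bounds

rowCell : ∀ {n} → Vec Bool n → ℕ → Bool
rowCell []       _       = false
rowCell (b ∷ _)  zero    = b
rowCell (_ ∷ bs) (suc j) = rowCell bs j

cell : ∀ {m n} → Vec (Vec Bool n) m → ℕ → ℕ → Bool
cell []       _       _ = false
cell (r ∷ _)  zero    j = rowCell r j
cell (_ ∷ rs) (suc i) j = cell rs i j

lookup≡rowCell : ∀ {n} (r : Vec Bool n) j → lookup r j ≡ rowCell r (toℕ j)
lookup≡rowCell (_ ∷ _)  fzero    = refl
lookup≡rowCell (_ ∷ bs) (fsuc j) = lookup≡rowCell bs j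

lookup≡cell : ∀ {m n} (g : Vec (Vec Bool n) m) i j →
              lookup (lookup g i) j ≡ cell g (toℕ i) (toℕ j)
lookup≡cell (r ∷ _)  fzero    j = lookup≡rowCell r j
lookup≡cell (_ ∷ rs) (fsuc i) j = lookup≡cell rs i j

rowCell-bound : ∀ {n} (r : Vec Bool n) j → rowCell r j ≡ true → j < n
rowCell-bound (_ ∷ _)  zero    _ = s≤s z≤n
rowCell-bound (_ ∷ bs) (suc j) e = s≤s (rowCell-bound bs j e)

cell-bound : ∀ {m n} (g : Vec (Vec Bool n) m) i j → cell g i j ≡ true → i < m × j < n
cell-bound (r ∷ _)  zero    j e = s≤s z≤n , rowCell-bound r j e
cell-bound (_ ∷ rs) (suc i) j e = map₁ s≤s (cell-bound rs i j e)

rowCell-ext : ∀ {n} (r r′ : Vec Bool n) → (∀ j → rowCell r j ≡ rowCell r′ j) → r ≡ r′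
rowCell-ext []       []         _ = refl
rowCell-ext (b ∷ bs) (b′ ∷ bs′) e = cong₂ _∷_ (e 0) (rowCell-ext bs bs′ (e ∘ suc))

cell-ext : ∀ {m n} (g g′ : Vec (Vec Bool n) m) → (∀ i j → cell g i j ≡ cell g′ i j) → g ≡ g′
cell-ext []       []         _ = refl
cell-ext (r ∷ rs) (r′ ∷ rs′) e = cong₂ _∷_ (rowCell-ext r r′ (e 0)) (cell-ext rs rs′ (e ∘ suc))

tabulateCells : ∀ m n → (ℕ → ℕ → Bool) → Vec (Vec Bool n) m
tabulateCells m n C = tabulate λ i → tabulate λ j → C (toℕ i) (toℕ j)

rowCell-tabulate : ∀ n f j → j < n → rowCell (tabulate {n = n} (f ∘ toℕ)) j ≡ f j
rowCell-tabulate (suc n) f zero    _       = refl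
rowCell-tabulate (suc n) f (suc j) (s≤s p) = rowCell-tabulate n (f ∘ suc) j p

cell-tabulateCells-< : ∀ m n C i j → i < m → j < n → cell (tabulateCells m n C) i j ≡ C i j
cell-tabulateCells-< (suc m) n C zero    j _       q = rowCell-tabulate n (C 0) j q
cell-tabulateCells-< (suc m) n C (suc i) j (s≤s p) q =
  cell-tabulateCells-< m n (C ∘ suc) i j p q

cell-tabulateCells : ∀ m n C → (∀ i j → C i j ≡ true → i < m × j < n) →
                     ∀ i j → cell (tabulateCells m n C) i j ≡ C i j
cell-tabulateCells m n C C-bound i j with i <? m ×-dec j <? n
... | yes (p , q) = cell-tabulateCells-< m n C i j p q
... | no outside   = trans (Bool.¬-not (outside ∘ cell-bound (tabulateCells m n C) i j))
                           (sym (Bool.¬-not (outside ∘ C-bound i j)))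

sumBelow : ℕ → (ℕ → ℕ) → ℕ
sumBelow zero    f = 0
sumBelow (suc n) f = f 0 + sumBelow n (f ∘ suc)

sum-tabulate≡sumBelow : ∀ n {f : Fin n → ℕ} {F : ℕ → ℕ} → (∀ i → f i ≡ F (toℕ i)) →
                        Vec.sum (tabulate f) ≡ sumBelow n F
sum-tabulate≡sumBelow zero    e = refl
sum-tabulate≡sumBelow (suc n) e = cong₂ _+_ (e fzero) (sum-tabulate≡sumBelow n (e ∘ fsuc))

sumBelow-cong : ∀ n {f g} → (∀ k → f k ≡ g k) → sumBelow n f ≡ sumBelow n g
sumBelow-cong zero    e = refl
sumBelow-cong (suc n) e = cong₂ _+_ (e 0) (sumBelow-cong n (e ∘ suc))

sumBelow-+ : ∀ n f g → sumBelow n (λ k → f k + g k) ≡ sumBelow n f + sumBelow n g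
sumBelow-+ zero    f g = refl
sumBelow-+ (suc n) f g = trans (cong (f 0 + g 0 +_) (sumBelow-+ n (f ∘ suc) (g ∘ suc)))
                               (interchange (f 0) (g 0) _ _)

sumBelow-double : ∀ n f → sumBelow (double n) f ≡ sumBelow n (λ a → f (double a) + f (suc (double a)))
sumBelow-double zero    f = refl
sumBelow-double (suc n) f = trans (sym (+-assoc (f 0) (f 1) _))
                                  (cong (f 0 + f 1 +_) (sumBelow-double n (f ∘ suc ∘ suc)))

largest : ∀ {P : ℕ → Set} → (∀ k → Dec (P k)) → ∀ n → (∀ k → P k → k < n) → ∃ P →
          ∃ λ k → P k × (∀ k′ → k < k′ → ¬ P k′)
largest     P? zero    bound (k , pk) = ⊥-elim (n≮0 (bound k pk))
largest {P} P? (suc n) bound (k , pk) with P? n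
... | yes pn = n , pn , λ k′ n<k′ pk′ → <⇒≱ n<k′ (s≤s⁻¹ (bound k′ pk′))
... | no ¬pn = largest P? n bound′ (k , pk)
  where
    bound′ : ∀ k → P k → k < n
    bound′ k pk with m≤n⇒m<n∨m≡n (s≤s⁻¹ (bound k pk))
    ... | inj₁ k<n  = k<n
    ... | inj₂ refl = ⊥-elim (¬pn pk)

bounded-ascent : ∀ {P : ℕ → Set} {n} → (∀ {a} → P a → a < n) →
                 (∀ {a} → P a → ∃ λ a′ → a < a′ × P a′) → ∀ {a} → ¬ P a
bounded-ascent {P} {n} bound ascend {a} = go n (m≤n+m n a)
  where
    go : ∀ k {a} → n ≤ a + k → ¬ P a
    go zero    {a} n≤ pa = <⇒≱ (bound pa) (≤-trans n≤ (≤-reflexive (+-identityʳ a)))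
    go (suc k) {a} n≤ pa with ascend pa
    ... | a′ , a<a′ , pa′ = go k (≤-trans n≤ (≤-trans (≤-reflexive (+-suc a k)) (+-monoˡ-≤ k a<a′))) pa′

module Board (C : ℕ → ℕ → Bool) where

  Dotᴺ : ℕ → ℕ → Set
  Dotᴺ i j = C i j ≡ true

  dotᴺ? : ∀ i j → Dec (Dotᴺ i j)
  dotᴺ? i j = C i j Bool.≟ true

  Aboveᴺ Belowᴺ Leftᴺ Rightᴺ : ℕ → ℕ → Set
  Aboveᴺ i j = ∃ λ k → k < i × Dotᴺ k j
  Belowᴺ i j = ∃ λ k → i < k × Dotᴺ k j
  Leftᴺ  i j = ∃ λ k → k < j × Dotᴺ i k
  Rightᴺ i j = ∃ λ k → j < k × Dotᴺ i k

  Leafᴺ : ℕ → ℕ → Set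
  Leafᴺ i j = Dotᴺ i j × ¬ Belowᴺ i j × ¬ Rightᴺ i j

  -- A leaf is short iff the cell just above it or just left of it is dotted; that dot is its parent.
  AdjacentDotᴺ : ℕ → ℕ → Set
  AdjacentDotᴺ i j = (∃ λ i′ → i ≡ suc i′ × Dotᴺ i′ j) ⊎ (∃ λ j′ → j ≡ suc j′ × Dotᴺ i j′)

  record IsCNATᴺ (h w : ℕ) : Set where
    field
      root-dotted   : Dotᴺ 0 0
      non-root      : ∀ i j → Dotᴺ i j → ¬ (i ≡ 0 × j ≡ 0) →
                      (Aboveᴺ i j × ¬ Leftᴺ i j) ⊎ (¬ Aboveᴺ i j × Leftᴺ i j)
      rows-nonempty : ∀ i → i ≤ h → ∃ λ j → Dotᴺ i j
      cols-nonempty : ∀ j → j ≤ w → ∃ λ i → Dotᴺ i j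
      complete      : ∀ i j → Dotᴺ i j →
                      (Belowᴺ i j × Rightᴺ i j) ⊎ (¬ Belowᴺ i j × ¬ Rightᴺ i j)

  AllLeavesShortᴺ : Set
  AllLeavesShortᴺ = ∀ i j → Leafᴺ i j → AdjacentDotᴺ i j

  leaf-stable : ∀ {i j} → ¬ ¬ Leafᴺ i j → Leafᴺ i j
  leaf-stable {i} {j} ¬¬leaf with dotᴺ? i j
  ... | yes d = d , (λ below → ¬¬leaf (λ leaf → proj₁ (proj₂ leaf) below))
                  , (λ right → ¬¬leaf (λ leaf → proj₂ (proj₂ leaf) right))
  ... | no ¬d = ⊥-elim (¬¬leaf (¬d ∘ proj₁))

  module Complete {h w : ℕ} (bound : ∀ i j → Dotᴺ i j → i < suc h × j < suc w)
                  (c : IsCNATᴺ h w) where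
    open IsCNATᴺ c

    leafRightOf : ∀ {i j} → Dotᴺ i j → ∃ λ j′ → j ≤ j′ × Leafᴺ i j′
    leafRightOf {i} {j} d
      with largest (λ k → j ≤? k ×-dec dotᴺ? i k) (suc w) (λ k → proj₂ ∘ bound i k ∘ proj₂)
                   (j , ≤-refl , d)
    ... | k , (j≤k , dk) , rightmost with complete i k dk
    ...   | inj₁ (_ , (k′ , k<k′ , dk′)) = ⊥-elim (rightmost k′ k<k′ (≤-trans j≤k (<⇒≤ k<k′) , dk′))
    ...   | inj₂ (¬below , ¬right)      = k , j≤k , dk , ¬below , ¬right

    leafBelow : ∀ {i j} → Dotᴺ i j → ∃ λ i′ → i ≤ i′ × Leafᴺ i′ j
    leafBelow {i} {j} d
      with largest (λ k → i ≤? k ×-dec dotᴺ? k j) (suc h) (λ k → proj₁ ∘ bound k j ∘ proj₂)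
                   (i , ≤-refl , d)
    ... | k , (i≤k , dk) , lowest with complete k j dk
    ...   | inj₁ ((k′ , k<k′ , dk′) , _) = ⊥-elim (lowest k′ k<k′ (≤-trans i≤k (<⇒≤ k<k′) , dk′))
    ...   | inj₂ (¬below , ¬right)      = k , i≤k , dk , ¬below , ¬right

    right⇒below : ∀ {i j} → Dotᴺ i j → Rightᴺ i j → Belowᴺ i j
    right⇒below {i} {j} d right with complete i j d
    ... | inj₁ (below , _)  = below
    ... | inj₂ (_ , ¬right) = ⊥-elim (¬right right)

    below⇒right : ∀ {i j} → Dotᴺ i j → Belowᴺ i j → Rightᴺ i j
    below⇒right {i} {j} d below with complete i j d
    ... | inj₁ (_ , right)  = right
    ... | inj₂ (¬below , _) = ⊥-elim (¬below below)

    rowLeaf : ∀ i → i ≤ h → ∃ λ j → Leafᴺ i j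
    rowLeaf i i≤h = let (j , d) = rows-nonempty i i≤h
                        (j′ , _ , leaf) = leafRightOf d in j′ , leaf

    colLeaf : ∀ j → j ≤ w → ∃ λ i → Leafᴺ i j
    colLeaf j j≤w = let (i , d) = cols-nonempty j j≤w
                        (i′ , _ , leaf) = leafBelow d in i′ , leaf

inFin : ∀ {n k} → k < n → Σ (Fin n) λ i → toℕ i ≡ k
inFin p = fromℕ< p , toℕ-fromℕ< p

nothing-between : ∀ {a b c} → b ≡ suc a → a < c → c < b → ⊥
nothing-between refl a<c c<b = <-irrefl refl (≤-trans a<c (s≤s⁻¹ c<b))

module OnGrid {h w : ℕ} (g : Grid h w) where
  open Board (cell g)

  ᴺ⇒dot : ∀ {i j} → Dotᴺ (toℕ i) (toℕ j) → Dot g i j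
  ᴺ⇒dot {i} {j} = trans (lookup≡cell g i j)

  dot⇒ᴺ : ∀ {i j} → Dot g i j → Dotᴺ (toℕ i) (toℕ j)
  dot⇒ᴺ {i} {j} = trans (sym (lookup≡cell g i j))

  onDots : {P : ℕ → ℕ → Set} → (∀ i j → Dot g i j → P (toℕ i) (toℕ j)) → ∀ i j → Dotᴺ i j → P i j
  onDots f i j d with inFin (proj₁ (cell-bound g i j d)) | inFin (proj₂ (cell-bound g i j d))
  ... | i′ , refl | j′ , refl = f i′ j′ (ᴺ⇒dot d)

  above⇒ᴺ : ∀ {i j} → Above g i j → Aboveᴺ (toℕ i) (toℕ j)
  above⇒ᴺ (k , lt , d) = toℕ k , lt , dot⇒ᴺ d

  ᴺ⇒above : ∀ {i j} → Aboveᴺ (toℕ i) (toℕ j) → Above g i j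
  ᴺ⇒above {i} (k , lt , d) with inFin (<-trans lt (toℕ<n i))
  ... | k′ , refl = k′ , lt , ᴺ⇒dot d

  left⇒ᴺ : ∀ {i j} → Left g i j → Leftᴺ (toℕ i) (toℕ j)
  left⇒ᴺ (k , lt , d) = toℕ k , lt , dot⇒ᴺ d

  ᴺ⇒left : ∀ {i j} → Leftᴺ (toℕ i) (toℕ j) → Left g i j
  ᴺ⇒left {j = j} (k , lt , d) with inFin (<-trans lt (toℕ<n j))
  ... | k′ , refl = k′ , lt , ᴺ⇒dot d

  below⇒ᴺ : ∀ {i j} → Below g i j → Belowᴺ (toℕ i) (toℕ j)
  below⇒ᴺ (k , lt , d) = toℕ k , lt , dot⇒ᴺ d

  ᴺ⇒below : ∀ {i j} → Belowᴺ (toℕ i) (toℕ j) → Below g i j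
  ᴺ⇒below {j = j} (k , lt , d) with inFin (proj₁ (cell-bound g k (toℕ j) d))
  ... | k′ , refl = k′ , lt , ᴺ⇒dot d

  right⇒ᴺ : ∀ {i j} → Right g i j → Rightᴺ (toℕ i) (toℕ j)
  right⇒ᴺ (k , lt , d) = toℕ k , lt , dot⇒ᴺ d

  ᴺ⇒right : ∀ {i j} → Rightᴺ (toℕ i) (toℕ j) → Right g i j
  ᴺ⇒right {i} (k , lt , d) with inFin (proj₂ (cell-bound g (toℕ i) k d))
  ... | k′ , refl = k′ , lt , ᴺ⇒dot d

  leaf⇒ᴺ : ∀ {i j} → Leaf g i j → Leafᴺ (toℕ i) (toℕ j)
  leaf⇒ᴺ (d , ¬below , ¬right) = dot⇒ᴺ d , ¬below ∘ ᴺ⇒below , ¬right ∘ ᴺ⇒right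

  ᴺ⇒leaf : ∀ {i j} → Leafᴺ (toℕ i) (toℕ j) → Leaf g i j
  ᴺ⇒leaf (d , ¬below , ¬right) = ᴺ⇒dot d , ¬below ∘ below⇒ᴺ , ¬right ∘ right⇒ᴺ

  isCNAT⇒ᴺ : IsCNAT g → IsCNATᴺ h w
  isCNAT⇒ᴺ c = record
    { root-dotted   = dot⇒ᴺ root-dotted
    ; non-root      = onDots λ i j d ¬root →
                        case-non-root (non-root i j d λ (e , e′) → ¬root (cong toℕ e , cong toℕ e′))
    ; rows-nonempty = λ i i≤h → let (i′ , e) = inFin (s≤s i≤h) ; (j , d) = rows-nonempty i′
                                in toℕ j , subst (λ k → Dotᴺ k (toℕ j)) e (dot⇒ᴺ d)
    ; cols-nonempty = λ j j≤w → let (j′ , e) = inFin (s≤s j≤w) ; (i , d) = cols-nonempty j′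
                                in toℕ i , subst (Dotᴺ (toℕ i)) e (dot⇒ᴺ d)
    ; complete      = onDots λ i j d → case-complete (IsCNAT.complete c i j d)
    }
    where
      open IsNAT (IsCNAT.isNAT c)
      case-non-root : ∀ {i j} → (Above g i j × ¬ Left g i j) ⊎ (¬ Above g i j × Left g i j) →
                      (Aboveᴺ (toℕ i) (toℕ j) × ¬ Leftᴺ (toℕ i) (toℕ j)) ⊎
                      (¬ Aboveᴺ (toℕ i) (toℕ j) × Leftᴺ (toℕ i) (toℕ j))
      case-non-root (inj₁ (above , ¬left)) = inj₁ (above⇒ᴺ above , ¬left ∘ ᴺ⇒left)
      case-non-root (inj₂ (¬above , left)) = inj₂ (¬above ∘ ᴺ⇒above , left⇒ᴺ left)
      case-complete : ∀ {i j} → Internal g i j ⊎ Leaf g i j →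
                      (Belowᴺ (toℕ i) (toℕ j) × Rightᴺ (toℕ i) (toℕ j)) ⊎
                      (¬ Belowᴺ (toℕ i) (toℕ j) × ¬ Rightᴺ (toℕ i) (toℕ j))
      case-complete (inj₁ (_ , below , right)) = inj₁ (below⇒ᴺ below , right⇒ᴺ right)
      case-complete (inj₂ leaf)                 = inj₂ (proj₂ (leaf⇒ᴺ leaf))

  ᴺ⇒isCNAT : IsCNATᴺ h w → IsCNAT g
  ᴺ⇒isCNAT c = record
    { isNAT = record
      { root-dotted   = ᴺ⇒dot root-dotted
      ; non-root      = λ i j d ¬root →
          case-non-root (non-root (toℕ i) (toℕ j) (dot⇒ᴺ d)
                                  λ (e , e′) → ¬root (toℕ-injective e , toℕ-injective e′))
      ; rows-nonempty = λ i → let (k , d) = rows-nonempty (toℕ i) (s≤s⁻¹ (toℕ<n i))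
                                  (j , e) = inFin (proj₂ (cell-bound g (toℕ i) k d))
                              in j , ᴺ⇒dot (subst (Dotᴺ (toℕ i)) (sym e) d)
      ; cols-nonempty = λ j → let (k , d) = cols-nonempty (toℕ j) (s≤s⁻¹ (toℕ<n j))
                                  (i , e) = inFin (proj₁ (cell-bound g k (toℕ j) d))
                              in i , ᴺ⇒dot (subst (λ k → Dotᴺ k (toℕ j)) (sym e) d)
      }
    ; complete = λ i j d → case-complete d (complete (toℕ i) (toℕ j) (dot⇒ᴺ d))
    }
    where
      open IsCNATᴺ c
      case-non-root : ∀ {i j} → (Aboveᴺ (toℕ i) (toℕ j) × ¬ Leftᴺ (toℕ i) (toℕ j)) ⊎
                                (¬ Aboveᴺ (toℕ i) (toℕ j) × Leftᴺ (toℕ i) (toℕ j)) →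
                      (Above g i j × ¬ Left g i j) ⊎ (¬ Above g i j × Left g i j)
      case-non-root (inj₁ (above , ¬left)) = inj₁ (ᴺ⇒above above , ¬left ∘ left⇒ᴺ)
      case-non-root (inj₂ (¬above , left)) = inj₂ (¬above ∘ above⇒ᴺ , ᴺ⇒left left)
      case-complete : ∀ {i j} → Dot g i j →
                      (Belowᴺ (toℕ i) (toℕ j) × Rightᴺ (toℕ i) (toℕ j)) ⊎
                      (¬ Belowᴺ (toℕ i) (toℕ j) × ¬ Rightᴺ (toℕ i) (toℕ j)) →
                      Internal g i j ⊎ Leaf g i j
      case-complete d (inj₁ (below , right))   = inj₁ (d , ᴺ⇒below below , ᴺ⇒right right)
      case-complete d (inj₂ (¬below , ¬right)) = inj₂ (d , ¬below ∘ below⇒ᴺ , ¬right ∘ right⇒ᴺ)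

  allLeavesShort⇒ᴺ : AllLeavesShort g → AllLeavesShortᴺ
  allLeavesShort⇒ᴺ short i j leaf =
    onDots {λ i j → Leafᴺ i j → AdjacentDotᴺ i j} adjacent i j (proj₁ leaf) leaf
    where
      adjacent : ∀ i j → Dot g i j → Leafᴺ (toℕ i) (toℕ j) → AdjacentDotᴺ (toℕ i) (toℕ j)
      adjacent i j _ leaf with proj₂ (short i j (ᴺ⇒leaf leaf))
      ... | inj₁ (i′ , (_ , d , _) , e) = inj₁ (toℕ i′ , e , dot⇒ᴺ d)
      ... | inj₂ (j′ , (_ , d , _) , e) = inj₂ (toℕ j′ , e , dot⇒ᴺ d)

  ᴺ⇒allLeavesShort : AllLeavesShortᴺ → AllLeavesShort g
  ᴺ⇒allLeavesShort short i j leaf with short (toℕ i) (toℕ j) (leaf⇒ᴺ leaf)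
  ... | inj₁ (k , e , d) with inFin (<-trans (≤-reflexive (sym e)) (toℕ<n i))
  ...   | i′ , refl =
    leaf , inj₁ (i′ , (≤-reflexive (sym e) , ᴺ⇒dot d , λ _ p q _ → nothing-between e p q) , e)
  ᴺ⇒allLeavesShort short i j leaf | inj₂ (k , e , d) with inFin (<-trans (≤-reflexive (sym e)) (toℕ<n j))
  ...   | j′ , refl =
    leaf , inj₂ (j′ , (≤-reflexive (sym e) , ᴺ⇒dot d , λ _ p q _ → nothing-between e p q) , e)

  isLeaf : ℕ → ℕ → Bool
  isLeaf i j with i <? suc h ×-dec j <? suc w
  ... | yes (p , q) = does (leaf? g (fromℕ< p) (fromℕ< q))
  ... | no _        = false

  isLeaf-toℕ : ∀ i j → isLeaf (toℕ i) (toℕ j) ≡ does (leaf? g i j)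
  isLeaf-toℕ i j with toℕ i <? suc h ×-dec toℕ j <? suc w
  ... | yes (p , q) rewrite fromℕ<-toℕ i p | fromℕ<-toℕ j q = refl
  ... | no outside  = ⊥-elim (outside (toℕ<n i , toℕ<n j))

  isLeaf⇒ᴺ : ∀ i j → isLeaf i j ≡ true → Leafᴺ i j
  isLeaf⇒ᴺ i j with i <? suc h ×-dec j <? suc w
  ... | yes (p , q) = λ e → subst₂ Leafᴺ (toℕ-fromℕ< p) (toℕ-fromℕ< q)
                                    (leaf⇒ᴺ (does≡true⇒ (leaf? g (fromℕ< p) (fromℕ< q)) e))
  ... | no _        = λ ()

  ᴺ⇒isLeaf : ∀ i j → Leafᴺ i j → isLeaf i j ≡ true
  ᴺ⇒isLeaf i j leaf =
    onDots {λ i j → Leafᴺ i j → isLeaf i j ≡ true}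
           (λ i j _ leaf → trans (isLeaf-toℕ i j) (dec-true (leaf? g i j) (ᴺ⇒leaf leaf)))
           i j (proj₁ leaf) leaf

  leafCount : ℕ → ℕ → ℕ
  leafCount i j = count (isLeaf i j)

  numLeaves≡sumBelow : numLeaves g ≡ sumBelow (suc h) λ i → sumBelow (suc w) (leafCount i)
  numLeaves≡sumBelow =
    sum-tabulate≡sumBelow (suc h) {F = λ i → sumBelow (suc w) (leafCount i)} λ i →
      sum-tabulate≡sumBelow (suc w) {F = leafCount (toℕ i)} λ j →
      cong count (sym (isLeaf-toℕ i j))

module Doubling (C L C′ : ℕ → ℕ → Bool)
  (L⇒leaf : ∀ a b → L a b ≡ true → Board.Leafᴺ C a b)
  (leaf⇒L : ∀ a b → Board.Leafᴺ C a b → L a b ≡ true)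
  (C′-ee : ∀ a b → C′ (double a) (double b) ≡ C a b)
  (C′-eo : ∀ a b → C′ (double a) (suc (double b)) ≡ L a b)
  (C′-oe : ∀ a b → C′ (suc (double a)) (double b) ≡ L a b)
  (C′-oo : ∀ a b → C′ (suc (double a)) (suc (double b)) ≡ false) where

  module A = Board C
  module B = Board C′

  dot-ee⇒dot : ∀ {a b} → B.Dotᴺ (double a) (double b) → A.Dotᴺ a b
  dot-ee⇒dot {a} {b} = trans (sym (C′-ee a b))

  dot⇒dot-ee : ∀ {a b} → A.Dotᴺ a b → B.Dotᴺ (double a) (double b)
  dot⇒dot-ee {a} {b} = trans (C′-ee a b)

  dot-eo⇒leaf : ∀ {a b} → B.Dotᴺ (double a) (suc (double b)) → A.Leafᴺ a b
  dot-eo⇒leaf {a} {b} d = L⇒leaf a b (trans (sym (C′-eo a b)) d)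

  leaf⇒dot-eo : ∀ {a b} → A.Leafᴺ a b → B.Dotᴺ (double a) (suc (double b))
  leaf⇒dot-eo {a} {b} leaf = trans (C′-eo a b) (leaf⇒L a b leaf)

  dot-oe⇒leaf : ∀ {a b} → B.Dotᴺ (suc (double a)) (double b) → A.Leafᴺ a b
  dot-oe⇒leaf {a} {b} d = L⇒leaf a b (trans (sym (C′-oe a b)) d)

  leaf⇒dot-oe : ∀ {a b} → A.Leafᴺ a b → B.Dotᴺ (suc (double a)) (double b)
  leaf⇒dot-oe {a} {b} leaf = trans (C′-oe a b) (leaf⇒L a b leaf)

  ¬dot-oo : ∀ {a b} → ¬ B.Dotᴺ (suc (double a)) (suc (double b))
  ¬dot-oo {a} {b} d with trans (sym (C′-oo a b)) d
  ... | ()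

  above-ee⇒above : ∀ {a b} → B.Aboveᴺ (double a) (double b) → A.Aboveᴺ a b
  above-ee⇒above (k , k< , d) with parity k
  ... | even c = c , double-cancel-< k< , dot-ee⇒dot d
  ... | odd c  = c , suc-double<double⇒< k< , proj₁ (dot-oe⇒leaf d)

  above⇒above-ee : ∀ {a b} → A.Aboveᴺ a b → B.Aboveᴺ (double a) (double b)
  above⇒above-ee (c , c< , d) = double c , double-mono-< c< , dot⇒dot-ee d

  left-ee⇒left : ∀ {a b} → B.Leftᴺ (double a) (double b) → A.Leftᴺ a b
  left-ee⇒left (k , k< , d) with parity k
  ... | even c = c , double-cancel-< k< , dot-ee⇒dot d
  ... | odd c  = c , suc-double<double⇒< k< , proj₁ (dot-eo⇒leaf d)

  left⇒left-ee : ∀ {a b} → A.Leftᴺ a b → B.Leftᴺ (double a) (double b)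
  left⇒left-ee (c , c< , d) = double c , double-mono-< c< , dot⇒dot-ee d

  below-ee⇒ : ∀ {a b} → B.Belowᴺ (double a) (double b) → A.Belowᴺ a b ⊎ A.Leafᴺ a b
  below-ee⇒ (k , <k , d) with parity k
  ... | even c = inj₁ (c , double-cancel-< <k , dot-ee⇒dot d)
  ... | odd c with m≤n⇒m<n∨m≡n (double<suc-double⇒≤ <k)
  ...   | inj₁ a<c = inj₁ (c , a<c , proj₁ (dot-oe⇒leaf d))
  ...   | inj₂ refl = inj₂ (dot-oe⇒leaf d)

  ⇒below-ee : ∀ {a b} → A.Belowᴺ a b ⊎ A.Leafᴺ a b → B.Belowᴺ (double a) (double b)
  ⇒below-ee (inj₁ (c , <c , d)) = double c , double-mono-< <c , dot⇒dot-ee d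
  ⇒below-ee (inj₂ leaf)         = _ , ≤-refl , leaf⇒dot-oe leaf

  right-ee⇒ : ∀ {a b} → B.Rightᴺ (double a) (double b) → A.Rightᴺ a b ⊎ A.Leafᴺ a b
  right-ee⇒ (k , <k , d) with parity k
  ... | even c = inj₁ (c , double-cancel-< <k , dot-ee⇒dot d)
  ... | odd c with m≤n⇒m<n∨m≡n (double<suc-double⇒≤ <k)
  ...   | inj₁ b<c = inj₁ (c , b<c , proj₁ (dot-eo⇒leaf d))
  ...   | inj₂ refl = inj₂ (dot-eo⇒leaf d)

  ⇒right-ee : ∀ {a b} → A.Rightᴺ a b ⊎ A.Leafᴺ a b → B.Rightᴺ (double a) (double b)
  ⇒right-ee (inj₁ (c , <c , d)) = double c , double-mono-< <c , dot⇒dot-ee d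
  ⇒right-ee (inj₂ leaf)         = _ , ≤-refl , leaf⇒dot-eo leaf

  module _ {a b : ℕ} (leaf : A.Leafᴺ a b) where
    private
      dot : A.Dotᴺ a b
      dot = proj₁ leaf
      ¬below : ¬ A.Belowᴺ a b
      ¬below = proj₁ (proj₂ leaf)
      ¬right : ¬ A.Rightᴺ a b
      ¬right = proj₂ (proj₂ leaf)

    left-eo : B.Leftᴺ (double a) (suc (double b))
    left-eo = double b , ≤-refl , dot⇒dot-ee dot

    ¬above-eo : ¬ B.Aboveᴺ (double a) (suc (double b))
    ¬above-eo (k , k< , d) with parity k
    ... | even c = proj₁ (proj₂ (dot-eo⇒leaf d)) (a , double-cancel-< k< , dot)
    ... | odd c  = ¬dot-oo d

    ¬below-eo : ¬ B.Belowᴺ (double a) (suc (double b))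
    ¬below-eo (k , <k , d) with parity k
    ... | even c = ¬below (c , double-cancel-< <k , proj₁ (dot-eo⇒leaf d))
    ... | odd c  = ¬dot-oo d

    ¬right-eo : ¬ B.Rightᴺ (double a) (suc (double b))
    ¬right-eo (k , <k , d) with parity k
    ... | even c = ¬right (c , suc-double<double⇒< <k , dot-ee⇒dot d)
    ... | odd c  = ¬right (c , suc-double<suc-double⇒< <k , proj₁ (dot-eo⇒leaf d))

    above-oe : B.Aboveᴺ (suc (double a)) (double b)
    above-oe = double a , ≤-refl , dot⇒dot-ee dot

    ¬left-oe : ¬ B.Leftᴺ (suc (double a)) (double b)
    ¬left-oe (k , k< , d) with parity k
    ... | even c = proj₂ (proj₂ (dot-oe⇒leaf d)) (b , double-cancel-< k< , dot)
    ... | odd c  = ¬dot-oo d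

    ¬below-oe : ¬ B.Belowᴺ (suc (double a)) (double b)
    ¬below-oe (k , <k , d) with parity k
    ... | even c = ¬below (c , suc-double<double⇒< <k , dot-ee⇒dot d)
    ... | odd c  = ¬below (c , suc-double<suc-double⇒< <k , proj₁ (dot-oe⇒leaf d))

    ¬right-oe : ¬ B.Rightᴺ (suc (double a)) (double b)
    ¬right-oe (k , <k , d) with parity k
    ... | even c = ¬right (c , double-cancel-< <k , proj₁ (dot-oe⇒leaf d))
    ... | odd c  = ¬dot-oo d

    leaf⇒leaf-eo : B.Leafᴺ (double a) (suc (double b))
    leaf⇒leaf-eo = leaf⇒dot-eo leaf , ¬below-eo , ¬right-eo

    leaf⇒leaf-oe : B.Leafᴺ (suc (double a)) (double b)
    leaf⇒leaf-oe = leaf⇒dot-oe leaf , ¬below-oe , ¬right-oe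

  ¬leaf-ee : ∀ {a b} → ¬ B.Leafᴺ (double a) (double b)
  ¬leaf-ee (d , ¬below , ¬right) =
    ¬right (⇒right-ee (inj₂ (dot-ee⇒dot d , ¬below ∘ ⇒below-ee ∘ inj₁ , ¬right ∘ ⇒right-ee ∘ inj₁)))

  leaf-eo⇒leaf : ∀ {a b} → B.Leafᴺ (double a) (suc (double b)) → A.Leafᴺ a b
  leaf-eo⇒leaf = dot-eo⇒leaf ∘ proj₁

  leaf-oe⇒leaf : ∀ {a b} → B.Leafᴺ (suc (double a)) (double b) → A.Leafᴺ a b
  leaf-oe⇒leaf = dot-oe⇒leaf ∘ proj₁

  doubled-isCNAT : ∀ {h w} → (∀ i j → A.Dotᴺ i j → i < suc h × j < suc w) →
                   A.IsCNATᴺ h w → B.IsCNATᴺ (suc (double h)) (suc (double w))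
  doubled-isCNAT {h} {w} bound c = record
    { root-dotted   = dot⇒dot-ee root-dotted
    ; non-root      = non-root′
    ; rows-nonempty = rows-nonempty′
    ; cols-nonempty = cols-nonempty′
    ; complete      = complete′
    }
    where
      open A.IsCNATᴺ c
      open A.Complete bound c

      non-root′ : ∀ i j → B.Dotᴺ i j → ¬ (i ≡ 0 × j ≡ 0) →
                  (B.Aboveᴺ i j × ¬ B.Leftᴺ i j) ⊎ (¬ B.Aboveᴺ i j × B.Leftᴺ i j)
      non-root′ i j d ¬root with parity i | parity j
      ... | even a | even b with non-root a b (dot-ee⇒dot d) (λ { (refl , refl) → ¬root (refl , refl) })
      ...   | inj₁ (above , ¬left) = inj₁ (above⇒above-ee above , ¬left ∘ left-ee⇒left)
      ...   | inj₂ (¬above , left) = inj₂ (¬above ∘ above-ee⇒above , left⇒left-ee left)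
      non-root′ i j d ¬root | even a | odd b = inj₂ (¬above-eo (dot-eo⇒leaf d) , left-eo (dot-eo⇒leaf d))
      non-root′ i j d ¬root | odd a | even b = inj₁ (above-oe (dot-oe⇒leaf d) , ¬left-oe (dot-oe⇒leaf d))
      non-root′ i j d ¬root | odd a | odd b  = ⊥-elim (¬dot-oo d)

      rows-nonempty′ : ∀ i → i ≤ suc (double h) → ∃ λ j → B.Dotᴺ i j
      rows-nonempty′ i i≤ with parity i
      ... | even a = let (b , d) = rows-nonempty a (double-cancel-≤ i≤) in double b , dot⇒dot-ee d
      ... | odd a  = let (b , leaf) = rowLeaf a (double-cancel-≤ (s≤s⁻¹ (m≤n⇒m≤1+n i≤)))
                     in double b , leaf⇒dot-oe leaf

      cols-nonempty′ : ∀ j → j ≤ suc (double w) → ∃ λ i → B.Dotᴺ i j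
      cols-nonempty′ j j≤ with parity j
      ... | even b = let (a , d) = cols-nonempty b (double-cancel-≤ j≤) in double a , dot⇒dot-ee d
      ... | odd b  = let (a , leaf) = colLeaf b (double-cancel-≤ (s≤s⁻¹ (m≤n⇒m≤1+n j≤)))
                     in double a , leaf⇒dot-eo leaf

      complete′ : ∀ i j → B.Dotᴺ i j → (B.Belowᴺ i j × B.Rightᴺ i j) ⊎ (¬ B.Belowᴺ i j × ¬ B.Rightᴺ i j)
      complete′ i j d with parity i | parity j
      ... | even a | even b with complete a b (dot-ee⇒dot d)
      ...   | inj₁ (below , right)   = inj₁ (⇒below-ee (inj₁ below) , ⇒right-ee (inj₁ right))
      ...   | inj₂ (¬below , ¬right) = inj₁ (⇒below-ee (inj₂ leaf) , ⇒right-ee (inj₂ leaf))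
        where leaf : A.Leafᴺ a b
              leaf = dot-ee⇒dot d , ¬below , ¬right
      complete′ i j d | even a | odd b = inj₂ (¬below-eo (dot-eo⇒leaf d) , ¬right-eo (dot-eo⇒leaf d))
      complete′ i j d | odd a | even b = inj₂ (¬below-oe (dot-oe⇒leaf d) , ¬right-oe (dot-oe⇒leaf d))
      complete′ i j d | odd a | odd b  = ⊥-elim (¬dot-oo d)

  doubled-allLeavesShort : B.AllLeavesShortᴺ
  doubled-allLeavesShort i j leaf with parity i | parity j
  ... | even a | even b = ⊥-elim (¬leaf-ee leaf)
  ... | even a | odd b  = inj₂ (double b , refl , dot⇒dot-ee (proj₁ (leaf-eo⇒leaf leaf)))
  ... | odd a  | even b = inj₁ (double a , refl , dot⇒dot-ee (proj₁ (leaf-oe⇒leaf leaf)))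
  ... | odd a  | odd b  = ⊥-elim (¬dot-oo (proj₁ leaf))

  undoubled-isCNAT : ∀ {h w} → B.IsCNATᴺ (suc (double h)) (suc (double w)) → A.IsCNATᴺ h w
  undoubled-isCNAT {h} {w} c = record
    { root-dotted   = dot-ee⇒dot root-dotted
    ; non-root      = non-root′
    ; rows-nonempty = rows-nonempty′
    ; cols-nonempty = cols-nonempty′
    ; complete      = complete′
    }
    where
      open B.IsCNATᴺ c

      non-root′ : ∀ a b → A.Dotᴺ a b → ¬ (a ≡ 0 × b ≡ 0) →
                  (A.Aboveᴺ a b × ¬ A.Leftᴺ a b) ⊎ (¬ A.Aboveᴺ a b × A.Leftᴺ a b)
      non-root′ a b d ¬root
        with non-root (double a) (double b) (dot⇒dot-ee d)
                 (λ (e , e′) → ¬root (double≡0⇒≡0 a e , double≡0⇒≡0 b e′))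
      ... | inj₁ (above , ¬left) = inj₁ (above-ee⇒above above , ¬left ∘ left⇒left-ee)
      ... | inj₂ (¬above , left) = inj₂ (¬above ∘ above⇒above-ee , left-ee⇒left left)

      rows-nonempty′ : ∀ a → a ≤ h → ∃ λ b → A.Dotᴺ a b
      rows-nonempty′ a a≤ with rows-nonempty (double a) (m≤n⇒m≤1+n (double-mono-≤ a≤))
      ... | k , d with parity k
      ...   | even c = c , dot-ee⇒dot d
      ...   | odd c  = c , proj₁ (dot-eo⇒leaf d)

      cols-nonempty′ : ∀ b → b ≤ w → ∃ λ a → A.Dotᴺ a b
      cols-nonempty′ b b≤ with cols-nonempty (double b) (m≤n⇒m≤1+n (double-mono-≤ b≤))
      ... | k , d with parity k
      ...   | even c = c , dot-ee⇒dot d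
      ...   | odd c  = c , proj₁ (dot-oe⇒leaf d)

      complete′ : ∀ a b → A.Dotᴺ a b → (A.Belowᴺ a b × A.Rightᴺ a b) ⊎ (¬ A.Belowᴺ a b × ¬ A.Rightᴺ a b)
      complete′ a b d with complete (double a) (double b) (dot⇒dot-ee d)
      ... | inj₂ (¬below , ¬right) = inj₂ (¬below ∘ ⇒below-ee ∘ inj₁ , ¬right ∘ ⇒right-ee ∘ inj₁)
      ... | inj₁ (below , right) with below-ee⇒ below | right-ee⇒ right
      ...   | inj₁ below′ | inj₁ right′ = inj₁ (below′ , right′)
      ...   | inj₂ leaf   | _           = inj₂ (proj₂ leaf)
      ...   | inj₁ _      | inj₂ leaf   = inj₂ (proj₂ leaf)

module Transpose (C : ℕ → ℕ → Bool) where
  module A = Board C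
  module B = Board (flip C)

  transpose-leaf : ∀ {i j} → A.Leafᴺ i j → B.Leafᴺ j i
  transpose-leaf (d , ¬below , ¬right) = d , ¬right , ¬below

  transpose-isCNAT : ∀ {h w} → A.IsCNATᴺ h w → B.IsCNATᴺ w h
  transpose-isCNAT c = record
    { root-dotted   = root-dotted
    ; non-root      = λ i j d ¬root → swap-cases (non-root j i d (¬root ∘ swap))
    ; rows-nonempty = cols-nonempty
    ; cols-nonempty = rows-nonempty
    ; complete      = λ i j d → Data.Sum.map swap swap (complete j i d)
    }
    where
      open A.IsCNATᴺ c
      swap-cases : ∀ {P Q R S : Set} → (P × Q) ⊎ (R × S) → (S × R) ⊎ (Q × P)
      swap-cases (inj₁ (p , q)) = inj₂ (q , p)
      swap-cases (inj₂ (r , s)) = inj₁ (s , r)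

  transpose-allLeavesShort : A.AllLeavesShortᴺ → B.AllLeavesShortᴺ
  transpose-allLeavesShort short i j (d , ¬below , ¬right) = Data.Sum.swap (short j i (d , ¬right , ¬below))

module ShortLeaves (C : ℕ → ℕ → Bool) {h w : ℕ}
  (bound : ∀ i j → Board.Dotᴺ C i j → i < suc h × j < suc w)
  (c : Board.IsCNATᴺ C h w) (short : Board.AllLeavesShortᴺ C) where
  open Board C
  open IsCNATᴺ c
  open Complete bound c public

  above⇒¬left : ∀ {i j} → Dotᴺ i j → Aboveᴺ i j → ¬ Leftᴺ i j
  above⇒¬left {i} {j} d above (k , k<j , dk)
    with non-root i j d (λ (_ , j≡0) → n≮0 (subst (k <_) j≡0 k<j))
  ... | inj₁ (_ , ¬left)  = ¬left (k , k<j , dk)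
  ... | inj₂ (¬above , _) = ¬above above

  leaf-above⇒parent-adjacent : ∀ {i j} → Leafᴺ i j → Aboveᴺ i j → ∃ λ i′ → i ≡ suc i′ × Dotᴺ i′ j
  leaf-above⇒parent-adjacent {i} {j} leaf above with short i j leaf
  ... | inj₁ adjacent          = adjacent
  ... | inj₂ (j′ , refl , d) = ⊥-elim (above⇒¬left (proj₁ leaf) above (j′ , ≤-refl , d))

  leaf-left⇒parent-adjacent : ∀ {i j} → Leafᴺ i j → Leftᴺ i j → ∃ λ j′ → j ≡ suc j′ × Dotᴺ i j′
  leaf-left⇒parent-adjacent {i} {j} leaf left with short i j leaf
  ... | inj₂ adjacent          = adjacent
  ... | inj₁ (i′ , refl , d) = ⊥-elim (above⇒¬left (proj₁ leaf) (i′ , ≤-refl , d) left)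

  rightLeaf-aloneInColumn : ∀ {i j} → Leafᴺ i (suc j) → Dotᴺ i j → ∀ k → Dotᴺ k (suc j) → k ≡ i
  rightLeaf-aloneInColumn {i} {j} (d , ¬below , _) dl k dk with <-cmp k i
  ... | tri< k<i _ _ = ⊥-elim (above⇒¬left d (k , k<i , dk) (j , ≤-refl , dl))
  ... | tri≈ _ k≡i _ = k≡i
  ... | tri> _ _ i<k = ⊥-elim (¬below (k , i<k , dk))

  lowerLeaf-aloneInRow : ∀ {i j} → Leafᴺ (suc i) j → Dotᴺ i j → ∀ k → Dotᴺ (suc i) k → k ≡ j
  lowerLeaf-aloneInRow {i} {j} (d , _ , ¬right) da k dk with <-cmp k j
  ... | tri< k<j _ _ = ⊥-elim (above⇒¬left d (i , ≤-refl , da) (k , k<j , dk))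
  ... | tri≈ _ k≡j _ = k≡j
  ... | tri> _ _ j<k = ⊥-elim (¬right (k , j<k , dk))

  UnpairedRightLeaf : ℕ → Set
  UnpairedRightLeaf a = ∃ λ b → Dotᴺ a b × Leafᴺ a (suc b) × ¬ Leafᴺ (suc a) b

  -- Below the parent (a, b) lies the lowest dot of column b, a leaf with parent (k′, b) where
  -- a < k′ because (a + 1, b) is no leaf.  The rightmost dot of row k′ is a leaf with parent (k′, L′);
  -- its sibling (k′ + 1, L′) would force L′ = b, as row k′ + 1 holds a single dot, and then column
  -- b + 1 would hold two right leaves.
  unpaired-ascends : ∀ {a} → UnpairedRightLeaf a → ∃ λ a′ → a < a′ × UnpairedRightLeaf a′
  unpaired-ascends {a} (b , dab , rightLeaf , ¬lowerLeaf)
    with right⇒below dab (suc b , ≤-refl , proj₁ rightLeaf)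
  ... | k , a<k , dkb with leafBelow dkb
  ... | K , k≤K , leafK with leaf-above⇒parent-adjacent leafK (a , <-≤-trans a<k k≤K , dab)
  ... | k′ , refl , dk′b with m≤n⇒m<n∨m≡n (s≤s⁻¹ (<-≤-trans a<k k≤K))
  ... | inj₂ refl  = ⊥-elim (¬lowerLeaf leafK)
  ... | inj₁ a<k′ with below⇒right dk′b (suc k′ , ≤-refl , proj₁ leafK)
  ... | l , b<l , dk′l with leafRightOf dk′l
  ... | L , l≤L , leafL with leaf-left⇒parent-adjacent leafL (b , <-≤-trans b<l l≤L , dk′b)
  ... | L′ , refl , dk′L′ = k′ , a<k′ , L′ , dk′L′ , leafL , ¬pair
    where
      ¬pair : ¬ Leafᴺ (suc k′) L′
      ¬pair leaf with lowerLeaf-aloneInRow leafK dk′b L′ (proj₁ leaf)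
      ... | refl = <-irrefl (rightLeaf-aloneInColumn leafL dk′b a (proj₁ rightLeaf)) a<k′

  rightLeaf⇒lowerLeaf : ∀ {a b} → Dotᴺ a b → Leafᴺ a (suc b) → Leafᴺ (suc a) b
  rightLeaf⇒lowerLeaf {a} {b} d leaf =
    leaf-stable λ ¬leaf → bounded-ascent (λ (b , d , _) → proj₁ (bound _ b d)) unpaired-ascends
                                         (b , d , leaf , ¬leaf)

module ShortRows (C : ℕ → ℕ → Bool) {h w : ℕ}
  (bound : ∀ i j → Board.Dotᴺ C i j → i < suc h × j < suc w)
  (c : Board.IsCNATᴺ C h w) (short : Board.AllLeavesShortᴺ C) where
  open Board C
  open ShortLeaves C bound c short public
  open Transpose C using (transpose-leaf; transpose-isCNAT; transpose-allLeavesShort)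
  private
    module ᵀ = ShortLeaves (flip C) (λ i j → swap ∘ bound j i) (transpose-isCNAT c)
                           (transpose-allLeavesShort short)

  lowerLeaf⇒rightLeaf : ∀ {a b} → Dotᴺ a b → Leafᴺ (suc a) b → Leafᴺ a (suc b)
  lowerLeaf⇒rightLeaf d leaf = let (d′ , ¬right , ¬below) = ᵀ.rightLeaf⇒lowerLeaf d (transpose-leaf leaf)
                               in d′ , ¬below , ¬right

  HasLowerLeaf : ℕ → Set
  HasLowerLeaf r = ∃ λ j → Leafᴺ r j × Aboveᴺ r j

  hasLowerLeaf⇒≤h : ∀ {r} → HasLowerLeaf r → r ≤ h
  hasLowerLeaf⇒≤h (j , leaf , _) = s≤s⁻¹ (proj₁ (bound _ j (proj₁ leaf)))

  ¬hasLowerLeaf-0 : ¬ HasLowerLeaf 0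
  ¬hasLowerLeaf-0 (_ , _ , _ , () , _)

  ¬hasLowerLeaf⇒next : ∀ {r} → r ≤ h → ¬ HasLowerLeaf r → HasLowerLeaf (suc r)
  ¬hasLowerLeaf⇒next {r} r≤h ¬lower with rowLeaf r r≤h
  ... | j , leaf with short r j leaf
  ...   | inj₁ (i′ , refl , d)  = ⊥-elim (¬lower (j , leaf , i′ , ≤-refl , d))
  ...   | inj₂ (j′ , refl , d) = j′ , rightLeaf⇒lowerLeaf d leaf , r , ≤-refl , d

  hasLowerLeaf⇒¬previous : ∀ {r} → HasLowerLeaf (suc r) → ¬ HasLowerLeaf r
  hasLowerLeaf⇒¬previous (j , leaf , above) (j′ , leaf′ , above′)
    with leaf-above⇒parent-adjacent leaf above | leaf-above⇒parent-adjacent leaf′ above′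
  ... | _ , refl , d | _ , refl , d′ =
    1+n≢n (trans (lowerLeaf-aloneInRow leaf′ d′ (suc j) (proj₁ (lowerLeaf⇒rightLeaf d leaf)))
                 (sym (lowerLeaf-aloneInRow leaf′ d′ j d)))

  lowerLeaves-alternate : ∀ a → double a ≤ h → ¬ HasLowerLeaf (double a) × HasLowerLeaf (suc (double a))
  lowerLeaves-alternate zero    _  = ¬hasLowerLeaf-0 , ¬hasLowerLeaf⇒next z≤n ¬hasLowerLeaf-0
  lowerLeaves-alternate (suc a) ≤h = ¬lower , ¬hasLowerLeaf⇒next ≤h ¬lower
    where
      ¬lower : ¬ HasLowerLeaf (double (suc a))
      ¬lower lower = hasLowerLeaf⇒¬previous lower
                       (proj₂ (lowerLeaves-alternate a (≤-trans (n≤1+n _) (≤-trans (n≤1+n _) ≤h))))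

  ¬hasLowerLeaf-even : ∀ a → ¬ HasLowerLeaf (double a)
  ¬hasLowerLeaf-even a lower = proj₁ (lowerLeaves-alternate a (hasLowerLeaf⇒≤h lower)) lower

  height-odd : Odd h
  height-odd with parity h
  ... | even a = ⊥-elim (1+n≰n (hasLowerLeaf⇒≤h (proj₂ (lowerLeaves-alternate a ≤-refl))))
  ... | odd a  = a , refl

  oddRow-dot⇒lowerLeaf : ∀ {a j} → Dotᴺ (suc (double a)) j → Leafᴺ (suc (double a)) j × Dotᴺ (double a) j
  oddRow-dot⇒lowerLeaf {a} {j} d
    with proj₂ (lowerLeaves-alternate a (≤-trans (n≤1+n _) (s≤s⁻¹ (proj₁ (bound _ j d)))))
  ... | j₀ , leaf , above with leaf-above⇒parent-adjacent leaf above
  ...   | _ , refl , d₀ with lowerLeaf-aloneInRow leaf d₀ j d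
  ...     | refl = leaf , d₀

evenPart : (ℕ → ℕ → Bool) → ℕ → ℕ → Bool
evenPart C a b = C (double a) (double b)

module ShortStructure (C : ℕ → ℕ → Bool) {h w : ℕ}
  (bound : ∀ i j → Board.Dotᴺ C i j → i < suc h × j < suc w)
  (c : Board.IsCNATᴺ C h w) (short : Board.AllLeavesShortᴺ C) where
  open Board C
  open IsCNATᴺ c
  open Transpose C using (transpose-leaf; transpose-isCNAT; transpose-allLeavesShort)
  module R = ShortRows C bound c short
  module Rᵀ = ShortRows (flip C) (λ i j → swap ∘ bound j i) (transpose-isCNAT c)
                        (transpose-allLeavesShort short)
  open R using (rightLeaf⇒lowerLeaf; lowerLeaf⇒rightLeaf)
  module E = Board (evenPart C)

  oddCol-dot⇒rightLeaf : ∀ {i b} → Dotᴺ i (suc (double b)) → Leafᴺ i (suc (double b)) × Dotᴺ i (double b)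
  oddCol-dot⇒rightLeaf d = let ((d′ , ¬right , ¬below) , d₀) = Rᵀ.oddRow-dot⇒lowerLeaf d
                           in (d′ , ¬below , ¬right) , d₀

  ¬dot-oo : ∀ {a b} → ¬ Dotᴺ (suc (double a)) (suc (double b))
  ¬dot-oo {a} {b} d with R.oddRow-dot⇒lowerLeaf d
  ... | leaf , d₀ =
    Rᵀ.¬hasLowerLeaf-even (suc b) (double a , transpose-leaf rightLeaf , suc (double b) , ≤-refl , d₀)
    where
      rightLeaf : Leafᴺ (double a) (suc (suc (double b)))
      rightLeaf = lowerLeaf⇒rightLeaf d₀ leaf

  dot-eo⇒evenLeaf : ∀ {a b} → Dotᴺ (double a) (suc (double b)) → E.Leafᴺ a b
  dot-eo⇒evenLeaf {a} {b} d =
    d₀ , (λ (c , a<c , dc) → proj₁ (proj₂ lowerLeaf) (double c , double-mono-≤ a<c , dc))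
       , (λ (c , b<c , dc) → proj₂ (proj₂ rightLeaf) (double c , double-mono-≤ b<c , dc))
    where
      rightLeaf : Leafᴺ (double a) (suc (double b))
      rightLeaf = proj₁ (oddCol-dot⇒rightLeaf d)
      d₀ : Dotᴺ (double a) (double b)
      d₀ = proj₂ (oddCol-dot⇒rightLeaf d)
      lowerLeaf : Leafᴺ (suc (double a)) (double b)
      lowerLeaf = rightLeaf⇒lowerLeaf d₀ rightLeaf

  dot-oe⇒evenLeaf : ∀ {a b} → Dotᴺ (suc (double a)) (double b) → E.Leafᴺ a b
  dot-oe⇒evenLeaf d = let (leaf , d₀) = R.oddRow-dot⇒lowerLeaf d
                      in dot-eo⇒evenLeaf (proj₁ (lowerLeaf⇒rightLeaf d₀ leaf))

  -- A leaf at (2a, 2b) would hang below or beside its parent in an even row or column, so (2a, 2b)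
  -- has a dot (2a, k) to its right; k = 2c + 1 is odd and c = b, for (2a, 2c) is dotted.
  evenLeaf⇒dot-eo : ∀ {a b} → E.Leafᴺ a b → Dotᴺ (double a) (suc (double b))
  evenLeaf⇒dot-eo {a} {b} (d , _ , ¬rightᴱ) with complete (double a) (double b) d
  ... | inj₂ (¬below , ¬right) with short _ _ (d , ¬below , ¬right)
  ...   | inj₁ (i′ , e , d′) =
    ⊥-elim (R.¬hasLowerLeaf-even a (double b , (d , ¬below , ¬right) , i′ , ≤-reflexive (sym e) , d′))
  ...   | inj₂ (j′ , e , d′) =
    ⊥-elim (Rᵀ.¬hasLowerLeaf-even b (double a , (d , ¬right , ¬below) , j′ , ≤-reflexive (sym e) , d′))
  evenLeaf⇒dot-eo {a} {b} (d , _ , ¬rightᴱ) | inj₁ (_ , k , <k , dk) with parity k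
  ... | even c = ⊥-elim (¬rightᴱ (c , double-cancel-< <k , dk))
  ... | odd c with m≤n⇒m<n∨m≡n (double<suc-double⇒≤ <k)
  ...   | inj₁ b<c  = ⊥-elim (¬rightᴱ (c , b<c , proj₂ (oddCol-dot⇒rightLeaf dk)))
  ...   | inj₂ refl = dk

  evenLeaf⇒dot-oe : ∀ {a b} → E.Leafᴺ a b → Dotᴺ (suc (double a)) (double b)
  evenLeaf⇒dot-oe leaf = let (leaf′ , d₀) = oddCol-dot⇒rightLeaf (evenLeaf⇒dot-eo leaf)
                         in proj₁ (rightLeaf⇒lowerLeaf d₀ leaf′)

doubled : (C L : ℕ → ℕ → Bool) → ℕ → ℕ → Bool
doubled C L i j =
  if isOdd i then (if isOdd j then false else L ⌊ i /2⌋ ⌊ j /2⌋)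
             else (if isOdd j then L ⌊ i /2⌋ ⌊ j /2⌋ else C ⌊ i /2⌋ ⌊ j /2⌋)

module _ (C L : ℕ → ℕ → Bool) (a b : ℕ) where
  doubled-ee : doubled C L (double a) (double b) ≡ C a b
  doubled-ee rewrite isOdd-double a | isOdd-double b | ⌊double/2⌋ a | ⌊double/2⌋ b = refl

  doubled-eo : doubled C L (double a) (suc (double b)) ≡ L a b
  doubled-eo rewrite isOdd-double a | isOdd-suc-double b | ⌊double/2⌋ a | ⌊suc-double/2⌋ b = refl

  doubled-oe : doubled C L (suc (double a)) (double b) ≡ L a b
  doubled-oe rewrite isOdd-suc-double a | isOdd-double b | ⌊suc-double/2⌋ a | ⌊double/2⌋ b = refl

  doubled-oo : doubled C L (suc (double a)) (suc (double b)) ≡ false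
  doubled-oo rewrite isOdd-suc-double a | isOdd-suc-double b = refl

expand : ∀ {h w} → Grid h w → Grid (suc (double h)) (suc (double w))
expand {h} {w} T = tabulateCells (double (suc h)) (double (suc w)) (doubled (cell T) (OnGrid.isLeaf T))

contract : ∀ {h w} → Grid h w → Grid ⌊ h /2⌋ ⌊ w /2⌋
contract {h} {w} g = tabulateCells (suc ⌊ h /2⌋) (suc ⌊ w /2⌋) (evenPart (cell g))

module Expand {h w : ℕ} (T : Grid h w) where
  private
    module T = OnGrid T
    module X = OnGrid (expand T)

  isLeaf-bound : ∀ {a b} → T.isLeaf a b ≡ true → a < suc h × b < suc w
  isLeaf-bound {a} {b} = cell-bound T a b ∘ proj₁ ∘ T.isLeaf⇒ᴺ a b

  doubled-bound : ∀ i j → doubled (cell T) T.isLeaf i j ≡ true → i < double (suc h) × j < double (suc w)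
  doubled-bound i j e with parity i | parity j
  ... | even a | even b = map double-mono-< double-mono-<
                            (cell-bound T a b (trans (sym (doubled-ee (cell T) T.isLeaf a b)) e))
  ... | even a | odd b  = map double-mono-< double-mono-≤
                            (isLeaf-bound (trans (sym (doubled-eo (cell T) T.isLeaf a b)) e))
  ... | odd a  | even b = map double-mono-≤ double-mono-<
                            (isLeaf-bound (trans (sym (doubled-oe (cell T) T.isLeaf a b)) e))
  ... | odd a  | odd b  with trans (sym (doubled-oo (cell T) T.isLeaf a b)) e
  ...   | ()

  cell-expand : ∀ i j → cell (expand T) i j ≡ doubled (cell T) T.isLeaf i j
  cell-expand =
    cell-tabulateCells (double (suc h)) (double (suc w)) (doubled (cell T) T.isLeaf) doubled-bound

  open Doubling (cell T) T.isLeaf (cell (expand T)) T.isLeaf⇒ᴺ T.ᴺ⇒isLeaf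
    (λ a b → trans (cell-expand (double a) (double b)) (doubled-ee (cell T) T.isLeaf a b))
    (λ a b → trans (cell-expand (double a) (suc (double b))) (doubled-eo (cell T) T.isLeaf a b))
    (λ a b → trans (cell-expand (suc (double a)) (double b)) (doubled-oe (cell T) T.isLeaf a b))
    (λ a b → trans (cell-expand (suc (double a)) (suc (double b))) (doubled-oo (cell T) T.isLeaf a b))

  expand-isCNAT : IsCNAT T → IsCNAT (expand T)
  expand-isCNAT c = X.ᴺ⇒isCNAT (doubled-isCNAT (cell-bound T) (T.isCNAT⇒ᴺ c))

  expand-allLeavesShort : AllLeavesShort (expand T)
  expand-allLeavesShort = X.ᴺ⇒allLeavesShort doubled-allLeavesShort

  expand-isCNAT⁻¹ : IsCNAT (expand T) → IsCNAT T
  expand-isCNAT⁻¹ c = T.ᴺ⇒isCNAT (undoubled-isCNAT (X.isCNAT⇒ᴺ c))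

  isLeaf-ee : ∀ a b → X.isLeaf (double a) (double b) ≡ false
  isLeaf-ee a b = Bool.¬-not (¬leaf-ee {a} {b} ∘ X.isLeaf⇒ᴺ (double a) (double b))

  isLeaf-eo : ∀ a b → X.isLeaf (double a) (suc (double b)) ≡ T.isLeaf a b
  isLeaf-eo a b = true⇔true⇒≡ (T.ᴺ⇒isLeaf a b ∘ leaf-eo⇒leaf ∘ X.isLeaf⇒ᴺ (double a) (suc (double b)))
                              (X.ᴺ⇒isLeaf (double a) (suc (double b)) ∘ leaf⇒leaf-eo ∘ T.isLeaf⇒ᴺ a b)

  isLeaf-oe : ∀ a b → X.isLeaf (suc (double a)) (double b) ≡ T.isLeaf a b
  isLeaf-oe a b = true⇔true⇒≡ (T.ᴺ⇒isLeaf a b ∘ leaf-oe⇒leaf ∘ X.isLeaf⇒ᴺ (suc (double a)) (double b))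
                              (X.ᴺ⇒isLeaf (suc (double a)) (double b) ∘ leaf⇒leaf-oe ∘ T.isLeaf⇒ᴺ a b)

  isLeaf-oo : ∀ a b → X.isLeaf (suc (double a)) (suc (double b)) ≡ false
  isLeaf-oo a b = Bool.¬-not (¬dot-oo {a} {b} ∘ proj₁ ∘ X.isLeaf⇒ᴺ (suc (double a)) (suc (double b)))

  leavesInRow-even : ∀ a → sumBelow (double (suc w)) (X.leafCount (double a)) ≡
                           sumBelow (suc w) (T.leafCount a)
  leavesInRow-even a = trans (sumBelow-double (suc w) (X.leafCount (double a))) (sumBelow-cong (suc w) λ b →
    cong₂ _+_ (cong count (isLeaf-ee a b)) (cong count (isLeaf-eo a b)))

  leavesInRow-odd : ∀ a → sumBelow (double (suc w)) (X.leafCount (suc (double a))) ≡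
                          sumBelow (suc w) (T.leafCount a)
  leavesInRow-odd a = trans (sumBelow-double (suc w) (X.leafCount (suc (double a))))
                            (sumBelow-cong (suc w) λ b →
    trans (cong₂ _+_ (cong count (isLeaf-oe a b)) (cong count (isLeaf-oo a b))) (+-identityʳ _))

  numLeaves-expand : numLeaves (expand T) ≡ 2 * numLeaves T
  numLeaves-expand = begin
    numLeaves (expand T)
      ≡⟨ X.numLeaves≡sumBelow ⟩
    sumBelow (double (suc h)) leavesInRowˣ
      ≡⟨ sumBelow-double (suc h) leavesInRowˣ ⟩
    sumBelow (suc h) (λ a → leavesInRowˣ (double a) + leavesInRowˣ (suc (double a)))
      ≡⟨ sumBelow-cong (suc h) (λ a → cong₂ _+_ (leavesInRow-even a) (leavesInRow-odd a)) ⟩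
    sumBelow (suc h) (λ a → leavesInRow a + leavesInRow a)
      ≡⟨ sumBelow-+ (suc h) leavesInRow leavesInRow ⟩
    sumBelow (suc h) leavesInRow + sumBelow (suc h) leavesInRow
      ≡⟨ cong₂ _+_ (sym T.numLeaves≡sumBelow) (trans (sym T.numLeaves≡sumBelow) (sym (+-identityʳ _))) ⟩
    2 * numLeaves T ∎
    where
      open ≡-Reasoning
      leavesInRowˣ : ℕ → ℕ
      leavesInRowˣ i = sumBelow (double (suc w)) (X.leafCount i)
      leavesInRow : ℕ → ℕ
      leavesInRow a = sumBelow (suc w) (T.leafCount a)

cell-contract : ∀ {h w} (g : Grid h w) → Odd h → Odd w →
                ∀ a b → cell (contract g) a b ≡ evenPart (cell g) a b
cell-contract {h} {w} g (h₀ , refl) (w₀ , refl) =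
  cell-tabulateCells _ _ (evenPart (cell g)) λ a b d →
    map halve halve (cell-bound g (double a) (double b) d)
  where
    halve : ∀ {a n} → double a < suc (suc (double n)) → a < suc ⌊ suc (double n) /2⌋
    halve {n = n} p rewrite ⌊suc-double/2⌋ n = s≤s (double-cancel-≤ (s≤s⁻¹ p))

leafᴺ-cong : ∀ {C C′ : ℕ → ℕ → Bool} → (∀ i j → C i j ≡ C′ i j) →
             ∀ {i j} → Board.Leafᴺ C i j → Board.Leafᴺ C′ i j
leafᴺ-cong e (d , ¬below , ¬right) =
  trans (sym (e _ _)) d , (λ (k , lt , dk) → ¬below (k , lt , trans (e _ _) dk))
                        , (λ (k , lt , dk) → ¬right (k , lt , trans (e _ _) dk))

AnyGrid : Set
AnyGrid = Σ ℕ λ h → Σ ℕ λ w → Grid h w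

rowsOf : AnyGrid → List (List Bool)
rowsOf (_ , _ , g) = toList (Vec.map toList g)

anyGrid-ext : ∀ {h w h′ w′} {g : Grid h w} {g′ : Grid h′ w′} → h ≡ h′ → w ≡ w′ →
              (∀ i j → cell g i j ≡ cell g′ i j) → (h , w , g) ≡ (h′ , w′ , g′)
anyGrid-ext refl refl e = cong (λ g → _ , _ , g) (cell-ext _ _ e)

rowsOf-injective : ∀ x y → rowsOf x ≡ rowsOf y → x ≡ y
rowsOf-injective (h , w , r ∷ rs) (h′ , w′ , r′ ∷ rs′) e with same-height | same-width
  where
    same-height : h ≡ h′
    same-height = suc-injective (trans (sym (Vecₚ.length-toList (Vec.map toList (r ∷ rs))))
                                 (trans (cong List.length e) (Vecₚ.length-toList (Vec.map toList (r′ ∷ rs′)))))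
    same-width : w ≡ w′
    same-width = suc-injective (trans (sym (Vecₚ.length-toList r))
                                (trans (cong List.length (∷-injectiveˡ e)) (Vecₚ.length-toList r′)))
... | refl | refl = cong (λ g → h , w , g) (rows-injective (r ∷ rs) (r′ ∷ rs′) e)
  where
    toList-injective : ∀ {n} (u v : Vec Bool n) → toList u ≡ toList v → u ≡ v
    toList-injective u v e = trans (sym (cast-is-id refl u)) (Vecₚ.toList-injective refl u v e)
    rows-injective : ∀ {m n} (g g′ : Vec (Vec Bool n) m) →
                     toList (Vec.map toList g) ≡ toList (Vec.map toList g′) → g ≡ g′
    rows-injective []       []         _ = refl
    rows-injective (r ∷ rs) (r′ ∷ rs′) e =
      cong₂ _∷_ (toList-injective r r′ (∷-injectiveˡ e)) (rows-injective rs rs′ (∷-injectiveʳ e))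

contractAny expandAny : AnyGrid → AnyGrid
contractAny (_ , _ , g) = _ , _ , contract g
expandAny   (_ , _ , T) = _ , _ , expand T

contract-expand : ∀ x → contractAny (expandAny x) ≡ x
contract-expand (h , w , T) = anyGrid-ext (⌊suc-double/2⌋ h) (⌊suc-double/2⌋ w) λ a b →
  trans (cell-contract (expand T) (h , refl) (w , refl) a b)
        (trans (Expand.cell-expand T (double a) (double b)) (doubled-ee (cell T) (OnGrid.isLeaf T) a b))

module Contract {h w : ℕ} (g : Grid h w) (c : IsCNAT g) (short : AllLeavesShort g) where
  private
    module G = OnGrid g
    module K = OnGrid (contract g)
  open ShortStructure (cell g) (cell-bound g) (G.isCNAT⇒ᴺ c) (G.allLeavesShort⇒ᴺ short)

  h-odd : Odd h
  h-odd = R.height-odd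

  w-odd : Odd w
  w-odd = Rᵀ.height-odd

  private
    cell-contract′ : ∀ a b → cell (contract g) a b ≡ evenPart (cell g) a b
    cell-contract′ = cell-contract g h-odd w-odd

  cell-eo≡isLeaf : ∀ a b → cell g (double a) (suc (double b)) ≡ K.isLeaf a b
  cell-eo≡isLeaf a b =
    true⇔true⇒≡ (K.ᴺ⇒isLeaf a b ∘ leafᴺ-cong (λ a b → sym (cell-contract′ a b)) ∘ dot-eo⇒evenLeaf)
                (evenLeaf⇒dot-eo ∘ leafᴺ-cong cell-contract′ ∘ K.isLeaf⇒ᴺ a b)

  cell-oe≡isLeaf : ∀ a b → cell g (suc (double a)) (double b) ≡ K.isLeaf a b
  cell-oe≡isLeaf a b =
    true⇔true⇒≡ (K.ᴺ⇒isLeaf a b ∘ leafᴺ-cong (λ a b → sym (cell-contract′ a b)) ∘ dot-oe⇒evenLeaf)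
                (evenLeaf⇒dot-oe ∘ leafᴺ-cong cell-contract′ ∘ K.isLeaf⇒ᴺ a b)

  cell≡doubled : ∀ i j → cell g i j ≡ doubled (cell (contract g)) K.isLeaf i j
  cell≡doubled i j with parity i | parity j
  ... | even a | even b = trans (sym (cell-contract′ a b)) (sym (doubled-ee (cell (contract g)) K.isLeaf a b))
  ... | even a | odd b  = trans (cell-eo≡isLeaf a b) (sym (doubled-eo (cell (contract g)) K.isLeaf a b))
  ... | odd a  | even b = trans (cell-oe≡isLeaf a b) (sym (doubled-oe (cell (contract g)) K.isLeaf a b))
  ... | odd a  | odd b  = trans (Bool.¬-not ¬dot-oo) (sym (doubled-oo (cell (contract g)) K.isLeaf a b))

  expand-contract : (h , w , g) ≡ expandAny (contractAny (h , w , g))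
  expand-contract = anyGrid-ext (dims h-odd) (dims w-odd) λ i j →
    trans (cell≡doubled i j) (sym (Expand.cell-expand (contract g) i j))
    where
      dims : ∀ {n} → Odd n → n ≡ suc (double ⌊ n /2⌋)
      dims (n₀ , refl) = cong (suc ∘ double) (sym (⌊suc-double/2⌋ n₀))

  numLeaves-contract : numLeaves g ≡ 2 * numLeaves (contract g)
  numLeaves-contract = trans (cong (λ (_ , _ , g) → numLeaves g) expand-contract)
                             (Expand.numLeaves-expand (contract g))

  contract-isCNAT : IsCNAT (contract g)
  contract-isCNAT = Expand.expand-isCNAT⁻¹ (contract g) (subst (λ (_ , _ , g) → IsCNAT g) expand-contract c)

shape : CNAT → AnyGrid
shape t = h t , w t , grid t

𝒜→𝒯 : ∀ {n} → 𝒜 (2 * n) → 𝒯 n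
𝒜→𝒯 (cnat _ _ g c , size≡ , short) =
  cnat _ _ (contract g) (Contract.contract-isCNAT g c short) ,
  *-cancelˡ-≡ _ _ 2 (trans (sym (Contract.numLeaves-contract g c short)) size≡)

𝒯→𝒜 : ∀ {n} → 𝒯 n → 𝒜 (2 * n)
𝒯→𝒜 (cnat _ _ T c , size≡) =
  cnat _ _ (expand T) (Expand.expand-isCNAT T c) ,
  trans (Expand.numLeaves-expand T) (cong (2 *_) size≡) , Expand.expand-allLeavesShort T

shape-expand-contract : ∀ {n} (x : 𝒜 n) → shape (proj₁ x) ≡ expandAny (contractAny (shape (proj₁ x)))
shape-expand-contract (cnat _ _ g c , _ , short) = Contract.expand-contract g c short

¬𝒜-odd : ∀ p → ¬ 𝒜 (suc (2 * p))
¬𝒜-odd p (cnat _ _ g c , size≡ , short) = double≢suc-double (numLeaves (contract g)) p (begin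
  double (numLeaves (contract g))   ≡⟨ sym (2*n≡double _) ⟩
  2 * numLeaves (contract g)        ≡⟨ sym (Contract.numLeaves-contract g c short) ⟩
  numLeaves g                       ≡⟨ size≡ ⟩
  suc (2 * p)                       ≡⟨ cong suc (2*n≡double p) ⟩
  suc (double p)                    ∎)
  where open ≡-Reasoning

𝒜↔𝒯 : ∀ n → Bijection (𝒜-setoid (2 * n)) (𝒯-setoid n)
𝒜↔𝒯 n = record
  { to        = 𝒜→𝒯
  ; cong      = λ {x} {y} → congruent {x} {y}
  ; bijective = (λ {x} {y} → injective {x} {y}) , surjective
  }
  where
    open Setoid (𝒜-setoid (2 * n)) using () renaming (_≈_ to _≈ᴬ_)
    open Setoid (𝒯-setoid n) using () renaming (_≈_ to _≈ᵀ_)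
    open ≡-Reasoning

    congruent : Congruent _≈ᴬ_ _≈ᵀ_ 𝒜→𝒯
    congruent {x} {y} e = cong (rowsOf ∘ contractAny) (rowsOf-injective (shape (proj₁ x)) (shape (proj₁ y)) e)

    injective : Injective _≈ᴬ_ _≈ᵀ_ 𝒜→𝒯
    injective {x} {y} e = cong rowsOf (begin
      shape (proj₁ x)                           ≡⟨ shape-expand-contract x ⟩
      expandAny (contractAny (shape (proj₁ x))) ≡⟨ cong expandAny (rowsOf-injective _ _ e) ⟩
      expandAny (contractAny (shape (proj₁ y))) ≡⟨ sym (shape-expand-contract y) ⟩
      shape (proj₁ y)                           ∎)

    surjective : Surjective _≈ᴬ_ _≈ᵀ_ 𝒜→𝒯
    surjective y = 𝒯→𝒜 y , λ {z} e → begin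
      rowsOf (contractAny (shape (proj₁ z)))             ≡⟨ congruent {z} {𝒯→𝒜 y} e ⟩
      rowsOf (contractAny (expandAny (shape (proj₁ y)))) ≡⟨ cong rowsOf (contract-expand (shape (proj₁ y))) ⟩
      rowsOf (shape (proj₁ y))                           ∎

proposition2 : ((p : ℕ) → ¬ 𝒜 (suc (2 * p))) ×
               ((p : ℕ) → Bijection (𝒜-setoid (2 * suc p)) (𝒯-setoid (suc p)))
proposition2 = ¬𝒜-odd , λ p → 𝒜↔𝒯 (suc p)
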